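{- For all integers $n,m\geq 0$ and any indeterminate $y$, \begin{align*} \sum_{k=0}^{n}\binom{n}{k}A_{n+m,m+k}(\mathbf{t})\,y^{k} &= \sum_{k=0}^{n}(-1)^{n-k}\binom{n}{k}\mathcal{Y}_{m+k}(\mathbf{t})(y+1)^{k}t_1^{n-k+1},\\ \sum_{k=0}^{n}\binom{n}{k}A_{m+k,m}(\mathbf{t})\,y^{n-k} &= t_1\sum_{k=0}^{n}\binom{n}{k}\mathcal{Y}_{m+k}(\mathbf{t})(y-t_1)^{n-k}. \end{align*}
   Context: $t_1,t_2,\dots$ are indeterminates. For a set partition $\pi$ assign each block of size $j$ the weight $t_j$, and let $w(\pi)$ be the product of its block weights. $\mathcal{Y}_n(\mathbf{t})$ is the sum of $w(\pi)$ over all partitions $\pi$ of $[n]=\{1,\dots,n\}$ ($\mathcal{Y}_0=1$). For $0\le k\le n$, $A_{n,k}(\mathbf{t})$ is the sum of $w(\pi)$ over all partitions of $[n+1]$ whose largest singleton block is $\{k+1\}$ (i.e. $\{k+1\}$ is a block and no $\{i\}$ with $i>k+1$ is a block). -}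

module Defs where

open import Data.Nat using (ℕ; zero; suc; _⊔_)
open import Data.List using (List; []; _∷_; [_]; map; concatMap; length; filter)
open import Algebra.Bundles using (CommutativeRing)
import Data.Nat as ℕ

-- Set partitions of [n] = {1,…,n}, represented as lists of blocks,
-- each block a list of its elements (natural numbers in 1..n).
-- All set partitions of [n+1] arise exactly once from the set
-- partitions of [n] by either adding {n+1} as a new block or inserting
-- n+1 into one of the existing blocks.

insertions : ℕ → List (List ℕ) → List (List (List ℕ))
insertions x []       = []
insertions x (b ∷ bs) = ((x ∷ b) ∷ bs) ∷ map (b ∷_) (insertions x bs)

partitions : ℕ → List (List (List ℕ))
partitions zero    = [] ∷ []
partitions (suc n) =
  concatMap (λ p → ([ suc n ] ∷ p) ∷ insertions (suc n) p) (partitions n)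

-- largest element of a singleton block of the partition (0 if none).
-- Since all elements are ≥ 1, "largestSingleton p = k+1" means:
-- {k+1} is a block and no {i} with i > k+1 is a block.
largestSingleton : List (List ℕ) → ℕ
largestSingleton []                  = 0
largestSingleton ((x ∷ []) ∷ bs)     = x ⊔ largestSingleton bs
largestSingleton (_ ∷ bs)            = largestSingleton bs

module _ {c ℓ} (R : CommutativeRing c ℓ) where
  open CommutativeRing R

  fromℕ : ℕ → Carrier
  fromℕ zero    = 0#
  fromℕ (suc n) = 1# + fromℕ n

  pow : Carrier → ℕ → Carrier
  pow x zero    = 1#
  pow x (suc n) = x * pow x n

  sumTo : ℕ → (ℕ → Carrier) → Carrier
  sumTo zero    f = f 0
  sumTo (suc n) f = sumTo n f + f (suc n)

  sumList : List Carrier → Carrier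
  sumList []       = 0#
  sumList (x ∷ xs) = x + sumList xs

  prodList : List Carrier → Carrier
  prodList []       = 1#
  prodList (x ∷ xs) = x * prodList xs

  weight : (ℕ → Carrier) → List (List ℕ) → Carrier
  weight t π = prodList (map (λ B → t (length B)) π)

  𝒴 : (ℕ → Carrier) → ℕ → Carrier
  𝒴 t n = sumList (map (weight t) (partitions n))

  A : (ℕ → Carrier) → ℕ → ℕ → Carrier
  A t n k = sumList (map (weight t)
              (filter (λ π → largestSingleton π ℕ.≟ suc k) (partitions (suc n))))

module Submission where

open import Defs
open import Data.Nat using (ℕ)
import Data.Nat as ℕ
open import Data.Nat.Combinatorics using (_C_)
open import Data.Product using (_×_; _,_)
open import Algebra.Bundles using (CommutativeRing)

-- The combinatorial input is a truncated partition sum: 𝒵 N k is the total weight of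
-- the partitions of [N] all of whose singleton blocks lie in [k].  We prove
--   𝒵 N N = 𝒴_N,    A_{N,k} = t₁ 𝒵 N k,    𝒵 (N+1) (k+1) = 𝒵 (N+1) k + t₁ 𝒵 N k  (k ≤ N).
-- The last two rest on one bijection (module SetPartitions): deleting the block {x}
-- from the partitions of [N+1] that contain it and relabelling the other elements
-- increasingly yields every partition of [N] exactly once.  The rest is algebra (BinomialSums, PartitionIdentities): after dividing
-- by t₁, the two sides of each identity are families F m n satisfying the same recurrence
-- F m (n+1) = a F m n + b F (m+1) n (by Pascal's rule and the recurrence of 𝒵) and
-- agreeing at n = 0, hence they are equal.

module SetPartitions where

  open import Data.Nat using (zero; suc; _≤_; _<_; _≟_; _<?_; s≤s)
  open import Data.Nat.Properties using (≤-refl; m≤n⇒m≤1+n; <⇒≱; ≤⇒≯; ≤-<-trans; m≤n⇒m<n∨m≡n)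
  open import Data.Bool using (Bool; true; false; if_then_else_; _∨_)
  open import Data.Bool.Properties using (∨-conicalˡ; ∨-conicalʳ)
  open import Data.List using (List; []; _∷_; [_]; map; concatMap; _++_; filterᵇ)
  open import Data.List.Properties
    using (map-++; map-∘; map-cong-local; map-id; filter-++; concatMap-cong; concatMap-map; map-concatMap)
  open import Data.List.Relation.Unary.All as All using (All; []; _∷_)
  open import Data.List.Relation.Unary.All.Properties using (concat⁺; map⁺)
  open import Data.Unit using (⊤; tt)
  open import Data.Sum using (inj₁; inj₂)
  open import Function using (_∘_)
  open import Relation.Nullary using (does; yes; no; contradiction)
  open import Relation.Nullary.Decidable using (dec-true; dec-false)
  open import Relation.Binary.PropositionalEquality
    using (_≡_; _≢_; refl; sym; trans; cong; cong₂; module ≡-Reasoning)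

  Block : Set
  Block = List ℕ

  Partition : Set
  Partition = List Block

  isSingleton : ℕ → Block → Bool
  isSingleton x (y ∷ []) = does (y ≟ x)
  isSingleton x _        = false

  hasSingleton : ℕ → Partition → Bool
  hasSingleton x []       = false
  hasSingleton x (b ∷ bs) = isSingleton x b ∨ hasSingleton x bs

  removeSingleton : ℕ → Partition → Partition
  removeSingleton x []       = []
  removeSingleton x (b ∷ bs) = if isSingleton x b then bs else b ∷ removeSingleton x bs

  skip : ℕ → ℕ → ℕ
  skip x i = if does (i <? x) then i else suc i

  -- Relabel a partition of [M] as a partition of [M+1] ∖ {x}.
  relabel : ℕ → Partition → Partition
  relabel x = map (map (skip x))

  -- The partitions of [n] obtained from a partition p of [n-1] by adding n;
  -- by definition  partitions (suc M) = concatMap (extensions (suc M)) (partitions M).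
  extensions : ℕ → Partition → List Partition
  extensions n p = ([ n ] ∷ p) ∷ insertions n p

  -- The shape invariant of the members of `partitions M`: blocks are nonempty,
  -- entries are at most M, and a singleton block occurs at most once.
  Valid : ℕ → Partition → Set
  Valid M []       = ⊤
  Valid M (b ∷ bs) = b ≢ [] × All (_≤ M) b
                   × (∀ x → isSingleton x b ≡ true → hasSingleton x bs ≡ false)
                   × Valid M bs

  filterᵇ-accept : ∀ {X : Set} (P : X → Bool) {a} as → P a ≡ true → filterᵇ P (a ∷ as) ≡ a ∷ filterᵇ P as
  filterᵇ-accept P as Pa rewrite Pa = refl

  removeSingleton-here : ∀ {x b} bs → isSingleton x b ≡ true → removeSingleton x (b ∷ bs) ≡ bs
  removeSingleton-here bs isX rewrite isX = refl

  removeSingleton-there : ∀ {x b} bs → isSingleton x b ≡ false → removeSingleton x (b ∷ bs) ≡ b ∷ removeSingleton x bs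
  removeSingleton-there bs notX rewrite notX = refl

  isSingleton-bounded : ∀ {M x} b → All (_≤ M) b → M < x → isSingleton x b ≡ false
  isSingleton-bounded []          _          _   = refl
  isSingleton-bounded (y ∷ [])    (y≤M ∷ []) M<x = dec-false (y ≟ _) λ { refl → <⇒≱ M<x y≤M }
  isSingleton-bounded (_ ∷ _ ∷ _) _          _   = refl

  hasSingleton-bounded : ∀ {M x} p → Valid M p → M < x → hasSingleton x p ≡ false
  hasSingleton-bounded []       _                   _   = refl
  hasSingleton-bounded (b ∷ bs) (_ , b≤M , _ , bsV) M<x
    rewrite isSingleton-bounded b b≤M M<x = hasSingleton-bounded bs bsV M<x

  isSingleton-∷ : ∀ x y b → b ≢ [] → isSingleton x (y ∷ b) ≡ false
  isSingleton-∷ x y []      b≢[] = contradiction refl b≢[]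
  isSingleton-∷ x y (_ ∷ _) _    = refl

  isSingleton-distinct : ∀ {x y} → y ≢ x → isSingleton x [ y ] ≡ false
  isSingleton-distinct {x} {y} y≢x = dec-false (y ≟ x) y≢x

  isSingleton-above : ∀ {M x} → x ≤ M → isSingleton x [ suc M ] ≡ false
  isSingleton-above {M} {x} x≤M = isSingleton-distinct {x} {suc M} λ { refl → <⇒≱ ≤-refl x≤M }

  isSingleton-refl : ∀ x → isSingleton x [ x ] ≡ true
  isSingleton-refl x = dec-true (x ≟ x) refl

  isSingleton-sound : ∀ {x} b → isSingleton x b ≡ true → b ≡ [ x ]
  isSingleton-sound {x} (y ∷ []) isX with y ≟ x
  ... | yes refl = refl
  ... | no  y≢x  = contradiction (trans (sym isX) (isSingleton-distinct y≢x)) λ ()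

  NoNewSingletons : Partition → Partition → Set
  NoNewSingletons p q = ∀ x → hasSingleton x p ≡ false → hasSingleton x q ≡ false

  ∨-false : ∀ {a b} → a ≡ false → b ≡ false → a ∨ b ≡ false
  ∨-false refl refl = refl

  insertions-noNewSingletons : ∀ {M} y p → Valid M p → All (NoNewSingletons p) (insertions y p)
  insertions-noNewSingletons y []       _                    = []
  insertions-noNewSingletons y (b ∷ bs) (b≢[] , _ , _ , bsV) =
    enlarged ∷ map⁺ (All.map (λ {q} → keepFirst {q}) (insertions-noNewSingletons y bs bsV))
    where
    enlarged : NoNewSingletons (b ∷ bs) ((y ∷ b) ∷ bs)
    enlarged x noX = ∨-false (isSingleton-∷ x y b b≢[]) (∨-conicalʳ (isSingleton x b) _ noX)
    keepFirst : ∀ {q} → NoNewSingletons bs q → NoNewSingletons (b ∷ bs) (b ∷ q)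
    keepFirst noNew x noX =
      ∨-false (∨-conicalˡ _ (hasSingleton x bs) noX) (noNew x (∨-conicalʳ (isSingleton x b) _ noX))

  Valid-weaken : ∀ {M} p → Valid M p → Valid (suc M) p
  Valid-weaken []       _                              = tt
  Valid-weaken (b ∷ bs) (b≢[] , b≤M , fresh , bsV) =
    b≢[] , All.map m≤n⇒m≤1+n b≤M , fresh , Valid-weaken bs bsV

  extensions-Valid : ∀ M p → Valid M p → All (Valid (suc M)) (extensions (suc M) p)
  extensions-Valid M p pV = newBlock ∷ inserted p pV
    where
    newBlock : Valid (suc M) ([ suc M ] ∷ p)
    newBlock = (λ ()) , ≤-refl ∷ [] , fresh , Valid-weaken p pV
      where
      fresh : ∀ x → isSingleton x [ suc M ] ≡ true → hasSingleton x p ≡ false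
      fresh x isX with refl ← isSingleton-sound {x} [ suc M ] isX = hasSingleton-bounded p pV ≤-refl
    inserted : ∀ q → Valid M q → All (Valid (suc M)) (insertions (suc M) q)
    inserted []       _                              = []
    inserted (b ∷ bs) (b≢[] , b≤M , fresh , bsV) =
      ((λ ()) , ≤-refl ∷ All.map m≤n⇒m≤1+n b≤M
              , (λ x isX → contradiction (trans (sym (isSingleton-∷ x (suc M) b b≢[])) isX) λ ())
              , Valid-weaken bs bsV)
      ∷ map⁺ (All.zipWith prepend (insertions-noNewSingletons (suc M) bs bsV , inserted bs bsV))
      where
      prepend : ∀ {q} → NoNewSingletons bs q × Valid (suc M) q → Valid (suc M) (b ∷ q)
      prepend (noNew , qV) = b≢[] , All.map m≤n⇒m≤1+n b≤M
                           , (λ x isX → noNew x (fresh x isX)) , qV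

  partitions-Valid : ∀ M → All (Valid M) (partitions M)
  partitions-Valid zero    = tt ∷ []
  partitions-Valid (suc M) =
    concat⁺ (map⁺ (All.map (λ {p} → extensions-Valid M p) (partitions-Valid M)))

  removeSingleton-under-singleton : ∀ {x b} → isSingleton x b ≡ true → ∀ L →
    map (removeSingleton x) (filterᵇ (hasSingleton x) (map (b ∷_) L)) ≡ L
  removeSingleton-under-singleton isX []      = refl
  removeSingleton-under-singleton isX (q ∷ L) rewrite isX =
    cong₂ _∷_ (removeSingleton-here q isX) (removeSingleton-under-singleton isX L)

  removeSingleton-under-other : ∀ {x b} → isSingleton x b ≡ false → ∀ L →
    map (removeSingleton x) (filterᵇ (hasSingleton x) (map (b ∷_) L))
      ≡ map (b ∷_) (map (removeSingleton x) (filterᵇ (hasSingleton x) L))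
  removeSingleton-under-other notX [] = refl
  removeSingleton-under-other {x} notX (q ∷ L) rewrite notX with hasSingleton x q
  ... | true  = cong₂ _∷_ (removeSingleton-there q notX) (removeSingleton-under-other notX L)
  ... | false = removeSingleton-under-other notX L

  removeSingleton-insertions : ∀ {M} x y p → Valid M p →
    map (removeSingleton x) (filterᵇ (hasSingleton x) (insertions y p))
      ≡ (if hasSingleton x p then insertions y (removeSingleton x p) else [])
  removeSingleton-insertions x y []       _                        = refl
  removeSingleton-insertions x y (b ∷ bs) (b≢[] , _ , fresh , bsV)
    rewrite isSingleton-∷ x y b b≢[] with isSingleton x b in isX
  ... | true rewrite fresh x isX = removeSingleton-under-singleton isX (insertions y bs)
  ... | false with hasSingleton x bs | removeSingleton-insertions x y bs bsV
  ...   | true  | ih =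
    cong₂ _∷_ (removeSingleton-there bs (isSingleton-∷ x y b b≢[]))
              (trans (removeSingleton-under-other isX (insertions y bs)) (cong (map (b ∷_)) ih))
  ...   | false | ih = trans (removeSingleton-under-other isX (insertions y bs)) (cong (map (b ∷_)) ih)

  filterᵇ-none : ∀ {X : Set} (P : X → Bool) {L} → All (λ a → P a ≡ false) L → filterᵇ P L ≡ []
  filterᵇ-none P []          = refl
  filterᵇ-none P (Pa ∷ rest) rewrite Pa = filterᵇ-none P rest

  map-filterᵇ-++ : ∀ {X Y : Set} (f : X → Y) (P : X → Bool) xs ys →
    map f (filterᵇ P (xs ++ ys)) ≡ map f (filterᵇ P xs) ++ map f (filterᵇ P ys)
  map-filterᵇ-++ f P xs ys = trans (cong (map f) (filter-++ _ xs ys)) (map-++ f (filterᵇ P xs) _)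

  -- The new element M+1 forms the singleton {M+1} only in the first extension of p.
  removeSingleton-extensions-new : ∀ M p → Valid M p →
    map (removeSingleton (suc M)) (filterᵇ (hasSingleton (suc M)) (extensions (suc M) p)) ≡ [ p ]
  removeSingleton-extensions-new M p pV = begin
    map (removeSingleton x) (filterᵇ (hasSingleton x) (([ x ] ∷ p) ∷ insertions x p))
      ≡⟨ cong (map (removeSingleton x))
              (filterᵇ-accept (hasSingleton x) {[ x ] ∷ p} _ (cong (_∨ hasSingleton x p) isX)) ⟩
    removeSingleton x ([ x ] ∷ p) ∷ map (removeSingleton x) (filterᵇ (hasSingleton x) (insertions x p))
      ≡⟨ cong₂ _∷_ (removeSingleton-here {x} {[ x ]} p isX) (cong (map (removeSingleton x)) noneInserted) ⟩
    p ∷ [] ∎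
    where
    open ≡-Reasoning
    x = suc M
    isX = isSingleton-refl x
    noneInserted : filterᵇ (hasSingleton x) (insertions x p) ≡ []
    noneInserted = filterᵇ-none (hasSingleton x)
      (All.map (λ noNew → noNew x (hasSingleton-bounded p pV ≤-refl)) (insertions-noNewSingletons x p pV))

  removeSingleton-extensions-old : ∀ {M x} p → Valid M p → x ≤ M →
    map (removeSingleton x) (filterᵇ (hasSingleton x) (extensions (suc M) p))
      ≡ (if hasSingleton x p then extensions (suc M) (removeSingleton x p) else [])
  removeSingleton-extensions-old {M} {x} p pV x≤M rewrite isSingleton-above x≤M
    with hasSingleton x p | removeSingleton-insertions x (suc M) p pV
  ... | true  | removedFromInsertions =
    cong₂ _∷_ (removeSingleton-there p (isSingleton-above x≤M)) removedFromInsertions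
  ... | false | removedFromInsertions = removedFromInsertions

  skip-below : ∀ {x i} → i < x → skip x i ≡ i
  skip-below {x} {i} i<x rewrite dec-true (i <? x) i<x = refl

  skip-above : ∀ {x i} → x ≤ i → skip x i ≡ suc i
  skip-above {x} {i} x≤i rewrite dec-false (i <? x) (≤⇒≯ x≤i) = refl

  relabel-bounded : ∀ {M x} p → Valid M p → M < x → relabel x p ≡ p
  relabel-bounded []       _                   _   = refl
  relabel-bounded (b ∷ bs) (_ , b≤M , _ , bsV) M<x =
    cong₂ _∷_ (trans (map-cong-local (All.map (λ i≤M → skip-below (≤-<-trans i≤M M<x)) b≤M)) (map-id b))
              (relabel-bounded bs bsV M<x)

  insertions-map : ∀ (f : ℕ → ℕ) y p → insertions (f y) (map (map f) p) ≡ map (map (map f)) (insertions y p)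
  insertions-map f y []       = refl
  insertions-map f y (b ∷ bs) = cong (((f y ∷ map f b) ∷ map (map f) bs) ∷_) (begin
    map (map f b ∷_) (insertions (f y) (map (map f) bs)) ≡⟨ cong (map (map f b ∷_)) (insertions-map f y bs) ⟩
    map (map f b ∷_) (map (map (map f)) (insertions y bs)) ≡⟨ map-∘ (insertions y bs) ⟨
    map (map (map f) ∘ (b ∷_)) (insertions y bs)          ≡⟨ map-∘ (insertions y bs) ⟩
    map (map (map f)) (map (b ∷_) (insertions y bs))      ∎)
    where open ≡-Reasoning

  extensions-map : ∀ (f : ℕ → ℕ) n p → extensions (f n) (map (map f) p) ≡ map (map (map f)) (extensions n p)
  extensions-map f n p = cong (((f n ∷ []) ∷ map (map f) p) ∷_) (insertions-map f n p)

  extensions-relabel : ∀ {M x} → x ≤ M → ∀ p →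
    extensions (suc M) (relabel x p) ≡ map (relabel x) (extensions M p)
  extensions-relabel {M} {x} x≤M p =
    trans (cong (λ n → extensions n (relabel x p)) (sym (skip-above x≤M))) (extensions-map (skip x) M p)

  removeSingleton-new-list : ∀ M L → All (Valid M) L →
    map (removeSingleton (suc M)) (filterᵇ (hasSingleton (suc M)) (concatMap (extensions (suc M)) L)) ≡ L
  removeSingleton-new-list M []      []         = refl
  removeSingleton-new-list M (p ∷ L) (pV ∷ LV) =
    trans (map-filterᵇ-++ (removeSingleton (suc M)) (hasSingleton (suc M)) (extensions (suc M) p) _)
          (cong₂ _++_ (removeSingleton-extensions-new M p pV) (removeSingleton-new-list M L LV))

  removeSingleton-old-list : ∀ {M x} L → All (Valid M) L → x ≤ M →
    map (removeSingleton x) (filterᵇ (hasSingleton x) (concatMap (extensions (suc M)) L))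
      ≡ concatMap (extensions (suc M)) (map (removeSingleton x) (filterᵇ (hasSingleton x) L))
  removeSingleton-old-list         []      []        _   = refl
  removeSingleton-old-list {M} {x} (p ∷ L) (pV ∷ LV) x≤M =
    trans (map-filterᵇ-++ (removeSingleton x) (hasSingleton x) (extensions (suc M) p) _)
          (trans (cong₂ _++_ (removeSingleton-extensions-old p pV x≤M) (removeSingleton-old-list L LV x≤M))
                 regroup)
    where
    regroup : (if hasSingleton x p then extensions (suc M) (removeSingleton x p) else [])
                ++ concatMap (extensions (suc M)) (map (removeSingleton x) (filterᵇ (hasSingleton x) L))
              ≡ concatMap (extensions (suc M)) (map (removeSingleton x) (filterᵇ (hasSingleton x) (p ∷ L)))
    regroup with hasSingleton x p
    ... | true  = refl
    ... | false = refl

  removeSingleton-partitions : ∀ {j M} → j ≤ M →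
    map (removeSingleton (suc j)) (filterᵇ (hasSingleton (suc j)) (partitions (suc M)))
      ≡ map (relabel (suc j)) (partitions M)
  removeSingleton-partitions {j} {M} j≤M with m≤n⇒m<n∨m≡n j≤M
  ... | inj₂ refl = begin
    map (removeSingleton (suc M)) (filterᵇ (hasSingleton (suc M)) (partitions (suc M)))
      ≡⟨ removeSingleton-new-list M (partitions M) (partitions-Valid M) ⟩
    partitions M
      ≡⟨ trans (map-cong-local (All.map (λ {p} pV → relabel-bounded p pV ≤-refl) (partitions-Valid M)))
               (map-id _) ⟨
    map (relabel (suc M)) (partitions M) ∎
    where open ≡-Reasoning
  ... | inj₁ (s≤s {n = M′} j≤M′) = begin
    map (removeSingleton x) (filterᵇ (hasSingleton x) (concatMap (extensions (suc M)) (partitions M)))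
      ≡⟨ removeSingleton-old-list (partitions M) (partitions-Valid M) (s≤s j≤M′) ⟩
    concatMap (extensions (suc M)) (map (removeSingleton x) (filterᵇ (hasSingleton x) (partitions M)))
      ≡⟨ cong (concatMap (extensions (suc M))) (removeSingleton-partitions j≤M′) ⟩
    concatMap (extensions (suc M)) (map (relabel x) (partitions M′))
      ≡⟨ concatMap-map (extensions (suc M)) (relabel x) (partitions M′) ⟩
    concatMap (extensions (suc M) ∘ relabel x) (partitions M′)
      ≡⟨ concatMap-cong (extensions-relabel (s≤s j≤M′)) (partitions M′) ⟩
    concatMap (map (relabel x) ∘ extensions M) (partitions M′)
      ≡⟨ map-concatMap (relabel x) (extensions M) (partitions M′) ⟨
    map (relabel x) (partitions M) ∎
    where
    open ≡-Reasoning
    x = suc j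

-- Weighted sums over set partitions, with a parameter for the weight of singletons.
module WeightedPartitions {c ℓ} (R : CommutativeRing c ℓ) (t : ℕ → CommutativeRing.Carrier R) where

  open SetPartitions
  open import Data.Nat using (suc; _≤_; _<_; _≤?_; _≟_; s≤s)
  open import Data.Nat.Properties
    using (≤-refl; ≤-trans; ≤-reflexive; n≤1+n; ≮⇒≥; ≰⇒>; ≤∧≢⇒<; <⇒≱; m≤m⊔n; m≤n⊔m; ⊔-sel)
  open import Data.Bool using (true; false; if_then_else_; _∨_; T?)
  open import Data.Bool.Properties using (T-≡; ∨-zeroʳ)
  open import Data.List using (List; []; _∷_; [_]; map; filter; filterᵇ; length)
  open import Data.List.Properties using (map-∘; length-map)
  open import Data.List.Relation.Unary.All as All using (All; []; _∷_)
  open import Data.List.Relation.Unary.All.Properties using (all-filter)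
  open import Data.Sum using (inj₁; inj₂)
  open import Function using (_∘_; Equivalence)
  open import Relation.Nullary using (does; yes; no; contradiction)
  open import Relation.Nullary.Decidable using (dec-true; dec-false)
  open import Relation.Unary using (Pred; Decidable)
  import Relation.Binary.PropositionalEquality as ≡
  open import Relation.Binary.PropositionalEquality using (_≢_)
  open import Level using (0ℓ)

  open CommutativeRing R
  open import Relation.Binary.Reasoning.Setoid setoid
  open import Algebra.Properties.CommutativeSemigroup *-commutativeSemigroup using () renaming (x∙yz≈y∙xz to x*yz≈y*xz)
  open import Algebra.Properties.CommutativeSemigroup +-commutativeSemigroup using () renaming (interchange to +-interchange)

  sumList-cong-local : ∀ {X : Set} {f g : X → Carrier} {L} → All (λ a → f a ≈ g a) L →
                       sumList R (map f L) ≈ sumList R (map g L)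
  sumList-cong-local []           = refl
  sumList-cong-local (fa≈ga ∷ eqs) = +-cong fa≈ga (sumList-cong-local eqs)

  sumList-cong : ∀ {X : Set} {f g : X → Carrier} → (∀ a → f a ≈ g a) → ∀ L →
                 sumList R (map f L) ≈ sumList R (map g L)
  sumList-cong f≈g L = sumList-cong-local (All.universal f≈g L)

  sumList-+ : ∀ {X : Set} (f g : X → Carrier) L →
              sumList R (map (λ a → f a + g a) L) ≈ sumList R (map f L) + sumList R (map g L)
  sumList-+ f g []      = sym (+-identityˡ 0#)
  sumList-+ f g (a ∷ L) = trans (+-congˡ (sumList-+ f g L)) (+-interchange _ _ _ _)

  sumList-* : ∀ {X : Set} (x : Carrier) (f : X → Carrier) L →
              sumList R (map (λ a → x * f a) L) ≈ x * sumList R (map f L)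
  sumList-* x f []      = sym (zeroʳ x)
  sumList-* x f (a ∷ L) = trans (+-congˡ (sumList-* x f L)) (sym (distribˡ x (f a) _))

  sumList-filter : ∀ {X : Set} {P : Pred X 0ℓ} (P? : Decidable P) (f : X → Carrier) L →
    sumList R (map f (filter P? L)) ≈ sumList R (map (λ a → if does (P? a) then f a else 0#) L)
  sumList-filter P? f []      = refl
  sumList-filter P? f (a ∷ L) with does (P? a)
  ... | true  = +-congˡ (sumList-filter P? f L)
  ... | false = trans (sumList-filter P? f L) (sym (+-identityˡ _))

  blockWeight : (ℕ → Carrier) → Block → Carrier
  blockWeight v (y ∷ []) = v y
  blockWeight v b        = t (length b)

  weightWith : (ℕ → Carrier) → Partition → Carrier
  weightWith v p = prodList R (map (blockWeight v) p)

  totalWeight : (ℕ → Carrier) → List Partition → Carrier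
  totalWeight v L = sumList R (map (weightWith v) L)

  weight-as-weightWith : ∀ p → weight R t p ≡.≡ weightWith (λ _ → t 1) p
  weight-as-weightWith []                 = ≡.refl
  weight-as-weightWith ([] ∷ bs)          = ≡.cong (t 0 *_) (weight-as-weightWith bs)
  weight-as-weightWith ((y ∷ []) ∷ bs)    = ≡.cong (t 1 *_) (weight-as-weightWith bs)
  weight-as-weightWith ((y ∷ z ∷ b) ∷ bs) = ≡.cong (t (length (y ∷ z ∷ b)) *_) (weight-as-weightWith bs)

  blockWeight-cong : ∀ {v v′} b → (∀ y → isSingleton y b ≡.≡ true → v y ≈ v′ y) →
                     blockWeight v b ≈ blockWeight v′ b
  blockWeight-cong []          _     = refl
  blockWeight-cong (y ∷ [])    v≈v′ = v≈v′ y (isSingleton-refl y)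
  blockWeight-cong (_ ∷ _ ∷ _) _     = refl

  weightWith-cong : ∀ {v v′} p → (∀ y → hasSingleton y p ≡.≡ true → v y ≈ v′ y) →
                    weightWith v p ≈ weightWith v′ p
  weightWith-cong []       _     = refl
  weightWith-cong (b ∷ bs) v≈v′ =
    *-cong (blockWeight-cong b λ y isY → v≈v′ y (≡.cong (_∨ hasSingleton y bs) isY))
           (weightWith-cong bs λ y hasY → v≈v′ y (≡.trans (≡.cong (isSingleton y b ∨_) hasY) (∨-zeroʳ _)))

  weightWith-map : ∀ v f p → weightWith v (map (map f) p) ≈ weightWith (v ∘ f) p
  weightWith-map v f []       = refl
  weightWith-map v f (b ∷ bs) = *-cong (block b) (weightWith-map v f bs)
    where
    block : ∀ b → blockWeight v (map f b) ≈ blockWeight (v ∘ f) b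
    block []          = refl
    block (y ∷ [])    = refl
    block (y ∷ z ∷ b) = reflexive (≡.cong (λ n → t (suc (suc n))) (length-map f b))

  weightWith-removeSingleton : ∀ v x p → hasSingleton x p ≡.≡ true →
                               weightWith v p ≈ v x * weightWith v (removeSingleton x p)
  weightWith-removeSingleton v x (b ∷ bs) hasX with isSingleton x b in isX
  ... | true with ≡.refl ← isSingleton-sound b isX = refl
  ... | false = begin
    blockWeight v b * weightWith v bs
      ≈⟨ *-congˡ (weightWith-removeSingleton v x bs hasX) ⟩
    blockWeight v b * (v x * weightWith v (removeSingleton x bs))
      ≈⟨ x*yz≈y*xz _ _ _ ⟩
    v x * weightWith v (b ∷ removeSingleton x bs) ∎

  weightWith-vanishes : ∀ v x p → hasSingleton x p ≡.≡ true → v x ≈ 0# → weightWith v p ≈ 0#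
  weightWith-vanishes v x p hasX vx≈0 =
    trans (weightWith-removeSingleton v x p hasX) (trans (*-congʳ vx≈0) (zeroˡ _))

  totalWeight-withSingleton : ∀ v {j M} → j ≤ M →
    totalWeight v (filterᵇ (hasSingleton (suc j)) (partitions (suc M)))
      ≈ v (suc j) * totalWeight (v ∘ skip (suc j)) (partitions M)
  totalWeight-withSingleton v {j} {M} j≤M = begin
    totalWeight v withX
      ≈⟨ sumList-cong-local (All.map (λ {p} hasX → weightWith-removeSingleton v x p (Equivalence.to T-≡ hasX))
                                      (all-filter (T? ∘ hasSingleton x) (partitions (suc M)))) ⟩
    sumList R (map (λ p → v x * weightWith v (removeSingleton x p)) withX)
      ≈⟨ sumList-* (v x) (weightWith v ∘ removeSingleton x) withX ⟩
    v x * sumList R (map (weightWith v ∘ removeSingleton x) withX)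
      ≡⟨ ≡.cong (λ L → v x * sumList R L) (map-∘ withX) ⟩
    v x * totalWeight v (map (removeSingleton x) withX)
      ≡⟨ ≡.cong (λ L → v x * totalWeight v L) (removeSingleton-partitions j≤M) ⟩
    v x * totalWeight v (map (relabel x) (partitions M))
      ≡⟨ ≡.cong (λ L → v x * sumList R L) (map-∘ (partitions M)) ⟨
    v x * sumList R (map (weightWith v ∘ relabel x) (partitions M))
      ≈⟨ *-congˡ (sumList-cong (weightWith-map v (skip x)) (partitions M)) ⟩
    v x * totalWeight (v ∘ skip x) (partitions M) ∎
    where
    x = suc j
    withX = filterᵇ (hasSingleton x) (partitions (suc M))

  -- Deleting x from the singleton weights (v′ x ≈ 0, v′ = v elsewhere) loses exactly the
  -- partitions having the block {x}.
  totalWeight-split : ∀ v v′ {j M} → j ≤ M → (∀ y → y ≢ suc j → v y ≈ v′ y) → v′ (suc j) ≈ 0# →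
    totalWeight v (partitions (suc M))
      ≈ totalWeight v′ (partitions (suc M)) + v (suc j) * totalWeight (v ∘ skip (suc j)) (partitions M)
  totalWeight-split v v′ {j} {M} j≤M v≈v′ v′x≈0 = begin
    totalWeight v L
      ≈⟨ sumList-cong separate L ⟩
    sumList R (map (λ p → weightWith v′ p + (if hasSingleton x p then weightWith v p else 0#)) L)
      ≈⟨ sumList-+ (weightWith v′) _ L ⟩
    totalWeight v′ L + sumList R (map (λ p → if hasSingleton x p then weightWith v p else 0#) L)
      ≈⟨ +-congˡ (sumList-filter (T? ∘ hasSingleton x) (weightWith v) L) ⟨
    totalWeight v′ L + totalWeight v (filterᵇ (hasSingleton x) L)
      ≈⟨ +-congˡ (totalWeight-withSingleton v j≤M) ⟩
    totalWeight v′ L + v x * totalWeight (v ∘ skip x) (partitions M) ∎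
    where
    x = suc j
    L = partitions (suc M)
    separate : ∀ p → weightWith v p ≈ weightWith v′ p + (if hasSingleton x p then weightWith v p else 0#)
    separate p with hasSingleton x p in hasX
    ... | true  = sym (trans (+-congʳ (weightWith-vanishes v′ x p hasX v′x≈0)) (+-identityˡ _))
    ... | false = trans (weightWith-cong p λ y hasY →
                          v≈v′ y λ { ≡.refl → contradiction (≡.trans (≡.sym hasY) hasX) λ () })
                        (sym (+-identityʳ _))

  -- 𝒵 N k is the total weight of the partitions of [N] all of whose singletons lie in [k]:
  -- a singleton {y} is weighted t 1 if y ≤ k and 0 otherwise.
  truncation : ℕ → ℕ → Carrier
  truncation k y = if does (y ≤? k) then t 1 else 0#

  𝒵 : ℕ → ℕ → Carrier
  𝒵 N k = totalWeight (truncation k) (partitions N)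

  truncation-≤ : ∀ {k y} → y ≤ k → truncation k y ≡.≡ t 1
  truncation-≤ {k} {y} y≤k rewrite dec-true (y ≤? k) y≤k = ≡.refl

  truncation-> : ∀ {k y} → k < y → truncation k y ≡.≡ 0#
  truncation-> {k} {y} k<y rewrite dec-false (y ≤? k) (<⇒≱ k<y) = ≡.refl

  truncation-skip : ∀ k y → truncation (suc k) (skip (suc k) y) ≡.≡ truncation k y
  truncation-skip k y with y ≤? k
  ... | yes y≤k rewrite skip-below {suc k} (s≤s y≤k) =
    ≡.trans (truncation-≤ (≤-trans y≤k (n≤1+n k))) (≡.sym (truncation-≤ y≤k))
  ... | no  y≰k rewrite skip-above {suc k} (≰⇒> y≰k) =
    ≡.trans (truncation-> (s≤s (≰⇒> y≰k))) (≡.sym (truncation-> (≰⇒> y≰k)))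

  removed-truncation : ∀ N k →
    truncation (suc k) (suc k) * totalWeight (truncation (suc k) ∘ skip (suc k)) (partitions N) ≈ t 1 * 𝒵 N k
  removed-truncation N k =
    *-cong (reflexive (truncation-≤ {suc k} ≤-refl))
           (sumList-cong (λ p → weightWith-cong p λ y _ → reflexive (truncation-skip k y)) (partitions N))

  weightWith-untruncated : ∀ k p → (∀ y → hasSingleton y p ≡.≡ true → y ≤ k) →
                           weightWith (truncation k) p ≈ weight R t p
  weightWith-untruncated k p bounded =
    trans (weightWith-cong p λ y hasY → reflexive (truncation-≤ (bounded y hasY)))
          (reflexive (≡.sym (weight-as-weightWith p)))

  -- No truncation happens at k = N, since all singletons of a partition of [N] lie in [N].
  𝒵-diagonal : ∀ N → 𝒵 N N ≈ 𝒴 R t N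
  𝒵-diagonal N =
    sumList-cong-local (All.map (λ {p} pV → weightWith-untruncated N p (bounded p pV)) (partitions-Valid N))
    where
    bounded : ∀ p → Valid N p → ∀ y → hasSingleton y p ≡.≡ true → y ≤ N
    bounded p pV y hasY = ≮⇒≥ λ N<y → contradiction (≡.trans (≡.sym hasY) (hasSingleton-bounded p pV N<y)) λ ()

  -- Recurrence in the truncation point: either {k+1} is a block or it is not.
  𝒵-step : ∀ N k → k ≤ N → 𝒵 (suc N) (suc k) ≈ 𝒵 (suc N) k + t 1 * 𝒵 N k
  𝒵-step N k k≤N = begin
    𝒵 (suc N) (suc k)
      ≈⟨ totalWeight-split (truncation (suc k)) (truncation k) k≤N agree (reflexive (truncation-> {k} ≤-refl)) ⟩
    𝒵 (suc N) k + truncation (suc k) (suc k) * totalWeight (truncation (suc k) ∘ skip (suc k)) (partitions N)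
      ≈⟨ +-congˡ (removed-truncation N k) ⟩
    𝒵 (suc N) k + t 1 * 𝒵 N k ∎
    where
    agree : ∀ y → y ≢ suc k → truncation (suc k) y ≈ truncation k y
    agree y y≢1+k with y ≤? k
    ... | yes y≤k = reflexive (≡.trans (truncation-≤ (≤-trans y≤k (n≤1+n k))) (≡.sym (truncation-≤ y≤k)))
    ... | no  y≰k = reflexive (≡.trans (truncation-> {suc k} (≤∧≢⇒< (≰⇒> y≰k) (y≢1+k ∘ ≡.sym)))
                                       (≡.sym (truncation-> {k} (≰⇒> y≰k))))

  largestSingleton-is-singleton : ∀ {x} p → largestSingleton p ≡.≡ suc x → hasSingleton (suc x) p ≡.≡ true
  largestSingleton-is-singleton ([] ∷ bs)          ls≡ = largestSingleton-is-singleton bs ls≡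
  largestSingleton-is-singleton ((_ ∷ _ ∷ _) ∷ bs) ls≡ = largestSingleton-is-singleton bs ls≡
  largestSingleton-is-singleton ((y ∷ []) ∷ bs)    ls≡ with ⊔-sel y (largestSingleton bs)
  ... | inj₁ ⊔≡y with ≡.refl ← ≡.trans (≡.sym ⊔≡y) ls≡ = ≡.cong (_∨ hasSingleton y bs) (isSingleton-refl y)
  ... | inj₂ ⊔≡ls =
    ≡.trans (≡.cong (isSingleton _ [ y ] ∨_) (largestSingleton-is-singleton bs (≡.trans (≡.sym ⊔≡ls) ls≡)))
            (∨-zeroʳ _)

  largestSingleton-∷ : ∀ b bs → largestSingleton bs ≤ largestSingleton (b ∷ bs)
  largestSingleton-∷ []          bs = ≤-refl
  largestSingleton-∷ (y ∷ [])    bs = m≤n⊔m y (largestSingleton bs)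
  largestSingleton-∷ (_ ∷ _ ∷ _) bs = ≤-refl

  largestSingleton-≥ : ∀ {x} p → hasSingleton x p ≡.≡ true → x ≤ largestSingleton p
  largestSingleton-≥ {x} (b ∷ bs) hasX with isSingleton x b in isX
  ... | true with ≡.refl ← isSingleton-sound b isX = m≤m⊔n x (largestSingleton bs)
  ... | false = ≤-trans (largestSingleton-≥ bs hasX) (largestSingleton-∷ b bs)

  largestSingleton-vanishes : ∀ k p → k < largestSingleton p → weightWith (truncation k) p ≈ 0#
  largestSingleton-vanishes k p k<ls with largestSingleton p in ls≡ | k<ls
  ... | suc x | k<1+x =
    weightWith-vanishes (truncation k) (suc x) p (largestSingleton-is-singleton p ls≡)
                        (reflexive (truncation-> k<1+x))

  -- Termwise, A N k counts the partitions of [N+1] having the block {k+1}, under truncation at k+1.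
  A-term : ∀ k p → (if does (largestSingleton p ≟ suc k) then weight R t p else 0#)
                   ≈ (if hasSingleton (suc k) p then weightWith (truncation (suc k)) p else 0#)
  A-term k p with largestSingleton p ≟ suc k
  ... | yes ls≡ rewrite dec-true (largestSingleton p ≟ suc k) ls≡ | largestSingleton-is-singleton p ls≡ =
    sym (weightWith-untruncated (suc k) p λ y hasY → ≤-trans (largestSingleton-≥ p hasY) (≤-reflexive ls≡))
  ... | no ls≢ rewrite dec-false (largestSingleton p ≟ suc k) ls≢ with hasSingleton (suc k) p in hasX
  ...   | false = refl
  ...   | true  = sym (largestSingleton-vanishes (suc k) p (≤∧≢⇒< (largestSingleton-≥ p hasX) (ls≢ ∘ ≡.sym)))

  -- Removing the largest singleton {k+1} from the partitions counted by A N k.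
  A-as-𝒵 : ∀ N k → k ≤ N → A R t N k ≈ t 1 * 𝒵 N k
  A-as-𝒵 N k k≤N = begin
    A R t N k
      ≈⟨ sumList-filter (λ p → largestSingleton p ≟ suc k) (weight R t) L ⟩
    sumList R (map (λ p → if does (largestSingleton p ≟ suc k) then weight R t p else 0#) L)
      ≈⟨ sumList-cong (A-term k) L ⟩
    sumList R (map (λ p → if hasSingleton (suc k) p then weightWith (truncation (suc k)) p else 0#) L)
      ≈⟨ sumList-filter (T? ∘ hasSingleton (suc k)) (weightWith (truncation (suc k))) L ⟨
    totalWeight (truncation (suc k)) (filterᵇ (hasSingleton (suc k)) L)
      ≈⟨ totalWeight-withSingleton (truncation (suc k)) k≤N ⟩
    truncation (suc k) (suc k) * totalWeight (truncation (suc k) ∘ skip (suc k)) (partitions N)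
      ≈⟨ removed-truncation N k ⟩
    t 1 * 𝒵 N k ∎
    where L = partitions (suc N)

module BinomialSums {c ℓ} (R : CommutativeRing c ℓ) where

  open import Data.Nat using (zero; suc; _≤_; _∸_; z≤n)
  open import Data.Nat.Properties using (≤-refl; ≤-trans; n≤1+n; n<1+n; +-∸-assoc; +-suc)
  open import Data.Nat.Combinatorics using (nCk+nC[k+1]≡[n+1]C[k+1]; k>n⇒nCk≡0)
  open import Function using (_∘_)
  import Relation.Binary.PropositionalEquality as ≡

  open CommutativeRing R
  open import Relation.Binary.Reasoning.Setoid setoid
  open import Algebra.Properties.CommutativeSemigroup +-commutativeSemigroup using () renaming (interchange to +-interchange)
  open import Algebra.Properties.CommutativeSemigroup *-commutativeSemigroup using () renaming (x∙yz≈y∙xz to x*yz≈y*xz)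
  open import Algebra.Solver.Ring.NaturalCoefficients.Default commutativeSemiring using (solve; _:+_; _:*_; _:=_)

  sumTo-cong : ∀ n {f g : ℕ → Carrier} → (∀ k → k ≤ n → f k ≈ g k) → sumTo R n f ≈ sumTo R n g
  sumTo-cong zero    f≈g = f≈g 0 z≤n
  sumTo-cong (suc n) f≈g = +-cong (sumTo-cong n λ k k≤n → f≈g k (≤-trans k≤n (n≤1+n n))) (f≈g (suc n) ≤-refl)

  sumTo-+ : ∀ n (f g : ℕ → Carrier) → sumTo R n (λ k → f k + g k) ≈ sumTo R n f + sumTo R n g
  sumTo-+ zero    f g = refl
  sumTo-+ (suc n) f g = trans (+-congʳ (sumTo-+ n f g)) (+-interchange _ _ _ _)

  sumTo-* : ∀ n (a : Carrier) (f : ℕ → Carrier) → sumTo R n (λ k → a * f k) ≈ a * sumTo R n f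
  sumTo-* zero    a f = refl
  sumTo-* (suc n) a f = trans (+-congʳ (sumTo-* n a f)) (sym (distribˡ a _ _))

  sumTo-first : ∀ n (f : ℕ → Carrier) → sumTo R (suc n) f ≈ f 0 + sumTo R n (f ∘ suc)
  sumTo-first zero    f = refl
  sumTo-first (suc n) f = trans (+-congʳ (sumTo-first n f)) (+-assoc _ _ _)

  fromℕ-+ : ∀ a b → fromℕ R (a ℕ.+ b) ≈ fromℕ R a + fromℕ R b
  fromℕ-+ zero    b = sym (+-identityˡ _)
  fromℕ-+ (suc a) b = trans (+-congˡ (fromℕ-+ a b)) (sym (+-assoc _ _ _))

  binomialSum : ℕ → (ℕ → ℕ → Carrier) → Carrier
  binomialSum n h = sumTo R n (λ k → fromℕ R (n C k) * h k (n ∸ k))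

  binomialSum-zero : ∀ h → binomialSum 0 h ≈ h 0 0
  binomialSum-zero h = trans (*-congʳ (+-identityʳ 1#)) (*-identityˡ _)

  binomialSum-cong : ∀ n (h h′ : ℕ → ℕ → Carrier) → (∀ k → k ≤ n → h k (n ∸ k) ≈ h′ k (n ∸ k)) →
                     binomialSum n h ≈ binomialSum n h′
  binomialSum-cong n h h′ h≈h′ = sumTo-cong n λ k k≤n → *-congˡ (h≈h′ k k≤n)

  -- Pascal's rule C(n+1,k+1) = C(n,k) + C(n,k+1), in summed form.
  binomialSum-pascal : ∀ n h →
    binomialSum (suc n) h ≈ binomialSum n (λ k j → h k (suc j)) + binomialSum n (λ k j → h (suc k) j)
  binomialSum-pascal n h = begin
    binomialSum (suc n) h
      ≈⟨ sumTo-first n _ ⟩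
    G 0 + sumTo R n (λ k → fromℕ R (suc n C suc k) * h (suc k) (n ∸ k))
      ≈⟨ +-congˡ (sumTo-cong n λ k _ → trans (*-congʳ (pascal k)) (distribʳ _ _ _)) ⟩
    G 0 + sumTo R n (λ k → fromℕ R (n C k) * h (suc k) (n ∸ k) + G (suc k))
      ≈⟨ +-congˡ (trans (sumTo-+ n _ _) (+-comm _ _)) ⟩
    G 0 + (sumTo R n (G ∘ suc) + binomialSum n (λ k j → h (suc k) j))
      ≈⟨ +-assoc _ _ _ ⟨
    (G 0 + sumTo R n (G ∘ suc)) + binomialSum n (λ k j → h (suc k) j)
      ≈⟨ +-congʳ (sumTo-first n G) ⟨
    (sumTo R n G + G (suc n)) + binomialSum n (λ k j → h (suc k) j)
      ≈⟨ +-congʳ (trans (+-congˡ lastVanishes) (+-identityʳ _)) ⟩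
    sumTo R n G + binomialSum n (λ k j → h (suc k) j)
      ≈⟨ +-congʳ (sumTo-cong n λ k k≤n → *-congˡ (reflexive (≡.cong (h k) (+-∸-assoc 1 k≤n)))) ⟩
    binomialSum n (λ k j → h k (suc j)) + binomialSum n (λ k j → h (suc k) j) ∎
    where
    pascal : ∀ k → fromℕ R (suc n C suc k) ≈ fromℕ R (n C k) + fromℕ R (n C suc k)
    pascal k = trans (reflexive (≡.cong (fromℕ R) (≡.sym (nCk+nC[k+1]≡[n+1]C[k+1] n k)))) (fromℕ-+ (n C k) (n C suc k))
    G : ℕ → Carrier
    G k = fromℕ R (n C k) * h k (suc n ∸ k)
    lastVanishes : G (suc n) ≈ 0#
    lastVanishes = trans (*-congʳ (reflexive (≡.cong (fromℕ R) (k>n⇒nCk≡0 (n<1+n n))))) (zeroˡ _)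

  binomialSum-+ : ∀ n h h′ → binomialSum n (λ k j → h k j + h′ k j) ≈ binomialSum n h + binomialSum n h′
  binomialSum-+ n h h′ = trans (sumTo-cong n λ k _ → distribˡ _ _ _) (sumTo-+ n _ _)

  binomialSum-* : ∀ n a h → binomialSum n (λ k j → a * h k j) ≈ a * binomialSum n h
  binomialSum-* n a h = trans (sumTo-cong n λ k _ → x*yz≈y*xz _ _ _) (sumTo-* n a _)

  binomialSum-step : ∀ n (a b : Carrier) (h g g′ : ℕ → ℕ → Carrier) →
    (∀ k → k ≤ n → h k (suc (n ∸ k)) + h (suc k) (n ∸ k) ≈ a * g k (n ∸ k) + b * g′ k (n ∸ k)) →
    binomialSum (suc n) h ≈ a * binomialSum n g + b * binomialSum n g′
  binomialSum-step n a b h g g′ recombine = begin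
    binomialSum (suc n) h
      ≈⟨ binomialSum-pascal n h ⟩
    binomialSum n (λ k j → h k (suc j)) + binomialSum n (λ k j → h (suc k) j)
      ≈⟨ binomialSum-+ n (λ k j → h k (suc j)) (λ k j → h (suc k) j) ⟨
    binomialSum n (λ k j → h k (suc j) + h (suc k) j)
      ≈⟨ binomialSum-cong n (λ k j → h k (suc j) + h (suc k) j) (λ k j → a * g k j + b * g′ k j) recombine ⟩
    binomialSum n (λ k j → a * g k j + b * g′ k j)
      ≈⟨ binomialSum-+ n (λ k j → a * g k j) (λ k j → b * g′ k j) ⟩
    binomialSum n (λ k j → a * g k j) + binomialSum n (λ k j → b * g′ k j)
      ≈⟨ +-cong (binomialSum-* n a g) (binomialSum-* n b g′) ⟩
    a * binomialSum n g + b * binomialSum n g′ ∎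

  recurrence-unique : ∀ (a b : Carrier) (F G : ℕ → ℕ → Carrier) →
    (∀ m n → F m (suc n) ≈ a * F m n + b * F (suc m) n) →
    (∀ m n → G m (suc n) ≈ a * G m n + b * G (suc m) n) →
    (∀ m → F m 0 ≈ G m 0) → ∀ n m → F m n ≈ G m n
  recurrence-unique a b F G stepF stepG base zero    m = base m
  recurrence-unique a b F G stepF stepG base (suc n) m = begin
    F m (suc n)                ≈⟨ stepF m n ⟩
    a * F m n + b * F (suc m) n ≈⟨ +-cong (*-congˡ (recurrence-unique a b F G stepF stepG base n m))
                                         (*-congˡ (recurrence-unique a b F G stepF stepG base n (suc m))) ⟩
    a * G m n + b * G (suc m) n ≈⟨ stepG m n ⟨
    G m (suc n)                ∎

  shiftedTerm : (ℕ → Carrier) → Carrier → Carrier → ℕ → ℕ → ℕ → Carrier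
  shiftedTerm Y a b m k j = Y (m ℕ.+ k) * pow R a k * pow R b j

  shiftedSum : (ℕ → Carrier) → Carrier → Carrier → ℕ → ℕ → Carrier
  shiftedSum Y a b m n = binomialSum n (shiftedTerm Y a b m)

  shiftedSum-zero : ∀ Y a b m → shiftedSum Y a b m 0 ≈ Y (m ℕ.+ 0)
  shiftedSum-zero Y a b m = trans (binomialSum-zero (shiftedTerm Y a b m)) (trans (*-identityʳ _) (*-identityʳ _))

  shiftedSum-step : ∀ Y a b m n →
    shiftedSum Y a b m (suc n) ≈ b * shiftedSum Y a b m n + a * shiftedSum Y a b (suc m) n
  shiftedSum-step Y a b m n =
    binomialSum-step n b a (shiftedTerm Y a b m) (shiftedTerm Y a b m) (shiftedTerm Y a b (suc m)) λ k _ →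
    trans (+-congˡ (*-congʳ (*-congʳ (reflexive (≡.cong Y (+-suc m k))))))
          (solve 6 (λ y y′ a b aᵏ bʲ → (y :* aᵏ) :* (b :* bʲ) :+ (y′ :* (a :* aᵏ)) :* bʲ
                                     := b :* ((y :* aᵏ) :* bʲ) :+ a :* ((y′ :* aᵏ) :* bʲ))
                   refl (Y (m ℕ.+ k)) (Y (suc m ℕ.+ k)) a b (pow R a k) (pow R b (n ∸ k)))

module PartitionIdentities {c ℓ} (R : CommutativeRing c ℓ) (t : ℕ → CommutativeRing.Carrier R) where

  open import Data.Nat using (zero; suc; _≤_; _∸_)
  open import Data.Nat.Properties as ℕₚ using (m≤m+n; +-monoʳ-≤)
  import Relation.Binary.PropositionalEquality as ≡
  open WeightedPartitions R t using (𝒵; 𝒵-step; 𝒵-diagonal; A-as-𝒵)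
  open BinomialSums R

  open CommutativeRing R
  open import Relation.Binary.Reasoning.Setoid setoid
  open import Algebra.Properties.Ring ring using (-‿distribˡ-*; -1*x≈-x)
  open import Algebra.Solver.Ring.NaturalCoefficients.Default commutativeSemiring using (solve; _:+_; _:*_; _:=_)

  𝒵-step⁻ : ∀ N k → k ≤ N → 𝒵 (suc N) k ≈ 𝒵 (suc N) (suc k) + (- t 1) * 𝒵 N k
  𝒵-step⁻ N k k≤N = begin
    𝒵 (suc N) k                                         ≈⟨ +-identityʳ _ ⟨
    𝒵 (suc N) k + 0#                                    ≈⟨ +-congˡ (-‿inverseʳ (t 1 * 𝒵 N k)) ⟨
    𝒵 (suc N) k + (t 1 * 𝒵 N k + - (t 1 * 𝒵 N k))       ≈⟨ +-assoc _ _ _ ⟨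
    (𝒵 (suc N) k + t 1 * 𝒵 N k) + - (t 1 * 𝒵 N k)       ≈⟨ +-cong (𝒵-step N k k≤N) (sym (-‿distribˡ-* (t 1) (𝒵 N k))) ⟨
    𝒵 (suc N) (suc k) + (- t 1) * 𝒵 N k                 ∎

  *-plus-itself : ∀ y x → y * x + x ≈ (y + 1#) * x
  *-plus-itself y x = trans (+-congˡ (sym (*-identityˡ x))) (sym (distribʳ x y 1#))

  pow-neg : ∀ x j → pow R (- 1#) j * pow R x j ≈ pow R (- x) j
  pow-neg x zero    = *-identityˡ 1#
  pow-neg x (suc j) =
    trans (solve 4 (λ a b c d → (a :* b) :* (c :* d) := (a :* c) :* (b :* d)) refl (- 1#) (pow R (- 1#) j) x (pow R x j))
          (*-cong (-1*x≈-x x) (pow-neg x j))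

  pow-one : ∀ k → pow R 1# k ≈ 1#
  pow-one zero    = refl
  pow-one (suc k) = trans (*-identityˡ _) (pow-one k)

  m+k≤n+m : ∀ {m k n} → k ≤ n → m ℕ.+ k ≤ n ℕ.+ m
  m+k≤n+m {m} {k} {n} k≤n = ≡.subst (m ℕ.+ k ≤_) (ℕₚ.+-comm m n) (+-monoʳ-≤ m k≤n)

  pullOut : ∀ {coef a z p} → a ≈ t 1 * z → coef * a * p ≈ t 1 * (coef * (z * p))
  pullOut {coef} {a} {z} {p} a≈t₁z =
    trans (*-congʳ (*-congˡ a≈t₁z))
          (solve 4 (λ coef t₁ z p → coef :* (t₁ :* z) :* p := t₁ :* (coef :* (z :* p))) refl coef (t 1) z p)

  module _ (y : Carrier) where

    -- Both sides of the first identity, divided by t₁, as families in (m, n).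
    firstTerm : ℕ → ℕ → ℕ → ℕ → Carrier
    firstTerm n m k j = 𝒵 (n ℕ.+ m) (m ℕ.+ k) * pow R y k

    firstLHS firstRHS : ℕ → ℕ → Carrier
    firstLHS m n = binomialSum n (firstTerm n m)
    firstRHS = shiftedSum (𝒴 R t) (y + 1#) (- t 1)

    -- Pascal's rule and 𝒵-step⁻ give the recurrence of firstRHS.
    firstLHS-step : ∀ m n → firstLHS m (suc n) ≈ (- t 1) * firstLHS m n + (y + 1#) * firstLHS (suc m) n
    firstLHS-step m n =
      binomialSum-step n (- t 1) (y + 1#) (firstTerm (suc n) m) (firstTerm n m) (firstTerm n (suc m)) recombine
      where
      recombine : ∀ k → k ≤ n → firstTerm (suc n) m k (suc (n ∸ k)) + firstTerm (suc n) m (suc k) (n ∸ k)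
                              ≈ (- t 1) * firstTerm n m k (n ∸ k) + (y + 1#) * firstTerm n (suc m) k (n ∸ k)
      recombine k k≤n = begin
        𝒵 (suc (n ℕ.+ m)) (m ℕ.+ k) * pow R y k + 𝒵 (suc (n ℕ.+ m)) (m ℕ.+ suc k) * (y * pow R y k)
          ≈⟨ +-cong (*-congʳ (𝒵-step⁻ (n ℕ.+ m) (m ℕ.+ k) (m+k≤n+m k≤n)))
                    (*-congʳ (reflexive (≡.cong (𝒵 (suc (n ℕ.+ m))) (ℕₚ.+-suc m k)))) ⟩
        (Q + (- t 1) * P) * pow R y k + Q * (y * pow R y k)
          ≈⟨ solve 5 (λ Q P s y p → (Q :+ s :* P) :* p :+ Q :* (y :* p) := s :* (P :* p) :+ (y :* (Q :* p) :+ Q :* p))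
                   refl Q P (- t 1) y (pow R y k) ⟩
        (- t 1) * (P * pow R y k) + (y * (Q * pow R y k) + Q * pow R y k)
          ≈⟨ +-congˡ (*-plus-itself y (Q * pow R y k)) ⟩
        (- t 1) * (P * pow R y k) + (y + 1#) * (Q * pow R y k)
          ≡⟨ ≡.cong (λ N → (- t 1) * (P * pow R y k) + (y + 1#) * (𝒵 N (suc m ℕ.+ k) * pow R y k))
                    (≡.sym (ℕₚ.+-suc n m)) ⟩
        (- t 1) * (P * pow R y k) + (y + 1#) * (𝒵 (n ℕ.+ suc m) (suc m ℕ.+ k) * pow R y k) ∎
        where
        P = 𝒵 (n ℕ.+ m) (m ℕ.+ k)
        Q = 𝒵 (suc (n ℕ.+ m)) (suc (m ℕ.+ k))

    firstBase : ∀ m → firstLHS m 0 ≈ firstRHS m 0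
    firstBase m = begin
      firstLHS m 0                                     ≈⟨ binomialSum-zero (firstTerm 0 m) ⟩
      𝒵 m (m ℕ.+ 0) * 1#                               ≈⟨ *-identityʳ _ ⟩
      𝒵 m (m ℕ.+ 0)                                    ≡⟨ ≡.cong (𝒵 m) (ℕₚ.+-identityʳ m) ⟩
      𝒵 m m                                            ≈⟨ 𝒵-diagonal m ⟩
      𝒴 R t m                                          ≡⟨ ≡.cong (𝒴 R t) (ℕₚ.+-identityʳ m) ⟨
      𝒴 R t (m ℕ.+ 0)                                  ≈⟨ shiftedSum-zero (𝒴 R t) (y + 1#) (- t 1) m ⟨
      firstRHS m 0                                     ∎

    -- Both sides of the second identity, divided by t₁, as families in (m, n).
    secondTerm : ℕ → ℕ → ℕ → Carrier
    secondTerm m k j = 𝒵 (m ℕ.+ k) m * pow R y j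

    secondLHS secondRHS : ℕ → ℕ → Carrier
    secondLHS m n = binomialSum n (secondTerm m)
    secondRHS = shiftedSum (𝒴 R t) 1# (y - t 1)

    -- Pascal's rule and 𝒵-step⁻ give the recurrence of secondRHS.
    secondLHS-step : ∀ m n → secondLHS m (suc n) ≈ (y - t 1) * secondLHS m n + 1# * secondLHS (suc m) n
    secondLHS-step m n =
      binomialSum-step n (y - t 1) 1# (secondTerm m) (secondTerm m) (secondTerm (suc m)) recombine
      where
      recombine : ∀ k → k ≤ n → secondTerm m k (suc (n ∸ k)) + secondTerm m (suc k) (n ∸ k)
                              ≈ (y - t 1) * secondTerm m k (n ∸ k) + 1# * secondTerm (suc m) k (n ∸ k)
      recombine k _ = begin
        P * (y * pow R y j) + 𝒵 (m ℕ.+ suc k) m * pow R y j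
          ≈⟨ +-congˡ (*-congʳ (trans (reflexive (≡.cong (λ N → 𝒵 N m) (ℕₚ.+-suc m k)))
                                     (𝒵-step⁻ (m ℕ.+ k) m (m≤m+n m k)))) ⟩
        P * (y * pow R y j) + (Q + (- t 1) * P) * pow R y j
          ≈⟨ solve 5 (λ P Q s y p → P :* (y :* p) :+ (Q :+ s :* P) :* p := (y :+ s) :* (P :* p) :+ Q :* p)
                   refl P Q (- t 1) y (pow R y j) ⟩
        (y - t 1) * (P * pow R y j) + Q * pow R y j
          ≈⟨ +-congˡ (*-identityˡ _) ⟨
        (y - t 1) * (P * pow R y j) + 1# * (Q * pow R y j) ∎
        where
        j = n ∸ k
        P = 𝒵 (m ℕ.+ k) m
        Q = 𝒵 (suc m ℕ.+ k) (suc m)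

    secondBase : ∀ m → secondLHS m 0 ≈ secondRHS m 0
    secondBase m = begin
      secondLHS m 0                                    ≈⟨ binomialSum-zero (secondTerm m) ⟩
      𝒵 (m ℕ.+ 0) m * 1#                               ≈⟨ *-identityʳ _ ⟩
      𝒵 (m ℕ.+ 0) m                                    ≡⟨ ≡.cong (𝒵 (m ℕ.+ 0)) (ℕₚ.+-identityʳ m) ⟨
      𝒵 (m ℕ.+ 0) (m ℕ.+ 0)                            ≈⟨ 𝒵-diagonal (m ℕ.+ 0) ⟩
      𝒴 R t (m ℕ.+ 0)                                  ≈⟨ shiftedSum-zero (𝒴 R t) 1# (y - t 1) m ⟨
      secondRHS m 0                                    ∎

    firstFamilies : ∀ n m → firstLHS m n ≈ firstRHS m n
    firstFamilies = recurrence-unique (- t 1) (y + 1#) firstLHS firstRHS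
                      firstLHS-step (shiftedSum-step (𝒴 R t) (y + 1#) (- t 1)) firstBase

    secondFamilies : ∀ n m → secondLHS m n ≈ secondRHS m n
    secondFamilies = recurrence-unique (y - t 1) 1# secondLHS secondRHS
                       secondLHS-step (shiftedSum-step (𝒴 R t) 1# (y - t 1)) secondBase

    firstIdentity : ∀ n m →
      sumTo R n (λ k → fromℕ R (n C k) * A R t (n ℕ.+ m) (m ℕ.+ k) * pow R y k)
        ≈ sumTo R n (λ k → pow R (- 1#) (n ∸ k) * fromℕ R (n C k) * 𝒴 R t (m ℕ.+ k)
                             * pow R (y + 1#) k * pow R (t 1) (n ∸ k ℕ.+ 1))
    firstIdentity n m = begin
      sumTo R n (λ k → fromℕ R (n C k) * A R t (n ℕ.+ m) (m ℕ.+ k) * pow R y k)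
        ≈⟨ sumTo-cong n (λ k k≤n → pullOut (A-as-𝒵 (n ℕ.+ m) (m ℕ.+ k) (m+k≤n+m k≤n))) ⟩
      sumTo R n (λ k → t 1 * (fromℕ R (n C k) * firstTerm n m k (n ∸ k)))
        ≈⟨ sumTo-* n (t 1) _ ⟩
      t 1 * firstLHS m n
        ≈⟨ *-congˡ (firstFamilies n m) ⟩
      t 1 * firstRHS m n
        ≈⟨ sumTo-* n (t 1) _ ⟨
      sumTo R n (λ k → t 1 * (fromℕ R (n C k) * shiftedTerm (𝒴 R t) (y + 1#) (- t 1) m k (n ∸ k)))
        ≈⟨ sumTo-cong n (λ k _ → rearrange k) ⟨
      sumTo R n (λ k → pow R (- 1#) (n ∸ k) * fromℕ R (n C k) * 𝒴 R t (m ℕ.+ k)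
                         * pow R (y + 1#) k * pow R (t 1) (n ∸ k ℕ.+ 1)) ∎
      where
      rearrange : ∀ k → pow R (- 1#) (n ∸ k) * fromℕ R (n C k) * 𝒴 R t (m ℕ.+ k)
                          * pow R (y + 1#) k * pow R (t 1) (n ∸ k ℕ.+ 1)
                        ≈ t 1 * (fromℕ R (n C k) * shiftedTerm (𝒴 R t) (y + 1#) (- t 1) m k (n ∸ k))
      rearrange k = begin
        pow R (- 1#) j * coef * Y * B * pow R (t 1) (j ℕ.+ 1)
          ≡⟨ ≡.cong (λ e → pow R (- 1#) j * coef * Y * B * pow R (t 1) e) (ℕₚ.+-comm j 1) ⟩
        pow R (- 1#) j * coef * Y * B * (t 1 * pow R (t 1) j)
          ≈⟨ solve 6 (λ s coef Y B t₁ p → s :* coef :* Y :* B :* (t₁ :* p) := t₁ :* (coef :* (Y :* B :* (s :* p))))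
                   refl (pow R (- 1#) j) coef Y B (t 1) (pow R (t 1) j) ⟩
        t 1 * (coef * (Y * B * (pow R (- 1#) j * pow R (t 1) j)))
          ≈⟨ *-congˡ (*-congˡ (*-congˡ (pow-neg (t 1) j))) ⟩
        t 1 * (coef * (Y * B * pow R (- t 1) j)) ∎
        where
        j = n ∸ k
        coef = fromℕ R (n C k)
        Y = 𝒴 R t (m ℕ.+ k)
        B = pow R (y + 1#) k

    secondIdentity : ∀ n m →
      sumTo R n (λ k → fromℕ R (n C k) * A R t (m ℕ.+ k) m * pow R y (n ∸ k))
        ≈ t 1 * sumTo R n (λ k → fromℕ R (n C k) * 𝒴 R t (m ℕ.+ k) * pow R (y - t 1) (n ∸ k))
    secondIdentity n m = begin
      sumTo R n (λ k → fromℕ R (n C k) * A R t (m ℕ.+ k) m * pow R y (n ∸ k))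
        ≈⟨ sumTo-cong n (λ k _ → pullOut (A-as-𝒵 (m ℕ.+ k) m (m≤m+n m k))) ⟩
      sumTo R n (λ k → t 1 * (fromℕ R (n C k) * secondTerm m k (n ∸ k)))
        ≈⟨ sumTo-* n (t 1) _ ⟩
      t 1 * secondLHS m n
        ≈⟨ *-congˡ (secondFamilies n m) ⟩
      t 1 * secondRHS m n
        ≈⟨ *-congˡ (binomialSum-cong n (shiftedTerm (𝒴 R t) 1# (y - t 1) m)
                                       (λ k j → 𝒴 R t (m ℕ.+ k) * pow R (y - t 1) j)
                                     λ k _ → *-congʳ (trans (*-congˡ (pow-one k)) (*-identityʳ _))) ⟩
      t 1 * sumTo R n (λ k → fromℕ R (n C k) * (𝒴 R t (m ℕ.+ k) * pow R (y - t 1) (n ∸ k)))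
        ≈⟨ *-congˡ (sumTo-cong n λ k _ → *-assoc _ _ _) ⟨
      t 1 * sumTo R n (λ k → fromℕ R (n C k) * 𝒴 R t (m ℕ.+ k) * pow R (y - t 1) (n ∸ k)) ∎

theorem2p6 : ∀ {c ℓ} (R : CommutativeRing c ℓ) (t : ℕ → CommutativeRing.Carrier R)
               (y : CommutativeRing.Carrier R) (n m : ℕ) →
               let open CommutativeRing R in
               (sumTo R n (λ k → fromℕ R (n C k) * A R t (n ℕ.+ m) (m ℕ.+ k) * pow R y k)
                 ≈ sumTo R n (λ k → pow R (- 1#) (n ℕ.∸ k) * fromℕ R (n C k) * 𝒴 R t (m ℕ.+ k)
                                      * pow R (y + 1#) k * pow R (t 1) (n ℕ.∸ k ℕ.+ 1)))
               ×
               (sumTo R n (λ k → fromℕ R (n C k) * A R t (m ℕ.+ k) m * pow R y (n ℕ.∸ k))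
                 ≈ t 1 * sumTo R n (λ k → fromℕ R (n C k) * 𝒴 R t (m ℕ.+ k) * pow R (y - t 1) (n ℕ.∸ k)))
theorem2p6 R t y n m = firstIdentity y n m , secondIdentity y n m
  where open PartitionIdentities R t
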